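{- Let $K$ be a field with $\mathrm{char}(K)\neq2,3$, $k\in K^*$, $E_k: y^2=x^3+\frac k4$, and let $\psi_k$ be the endomorphism of $E_k$ given by $\psi_k(P)=\mathcal{O}$ for $P\in\{\mathcal{O},\pm(0,\sqrt k/2)\}$ and $\psi_k(x,y)=\left(-\frac{x^3+k}{3x^2},-y\frac{x^3-2k}{3\sqrt{ -3}x^3}\right)$ otherwise (fixed $\sqrt{ -3},\sqrt k\in\overline K$). For $P\in E_k(\overline K)$, $$\psi_k(P)=P\iff 2P=\mathcal{O}\iff P\in\{\mathcal{O}\}\cup\{(-c,0): c\in\overline K,\ c^3=k/4\}.$$ -}

module Defs where

open import Level using (Level; _⊔_; suc)
open import Algebra.Bundles using (CommutativeRing)
open import Data.List using (List; []; _∷_)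
open import Data.Product using (Σ; ∃; _×_; _,_)
open import Data.Sum using (_⊎_)
open import Relation.Nullary using (¬_)
open import Data.Unit.Polymorphic using (⊤)

record Field (c ℓ : Level) : Set (suc (c ⊔ ℓ)) where
  field
    commutativeRing : CommutativeRing c ℓ
  open CommutativeRing commutativeRing public
  field
    1≉0     : ¬ (1# ≈ 0#)
    inverse : ∀ x → ¬ (x ≈ 0#) → Σ Carrier λ y → x * y ≈ 1#

module FieldTheory {c ℓ : Level} (F : Field c ℓ) where
  open Field F

  two three : Carrier
  two   = 1# + 1#
  three = 1# + 1# + 1#

  CharNot2or3 : Set ℓ
  CharNot2or3 = ¬ (two ≈ 0#) × ¬ (three ≈ 0#)

  -- value at x of the monic polynomial  a₀ + a₁x + … + a_{n-1}x^{n-1} + xⁿ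
  -- where the list is [a₀, …, a_{n-1}]
  evalMonic : List Carrier → Carrier → Carrier
  evalMonic []       x = 1#
  evalMonic (a ∷ as) x = a + x * evalMonic as x

  AlgClosed : Set (c ⊔ ℓ)
  AlgClosed = ∀ (a : Carrier) (as : List Carrier) → ∃ λ x → evalMonic (a ∷ as) x ≈ 0#

  cube : Carrier → Carrier
  cube x = x * x * x

  -- Points of the curve  y² = x³ + b  (b will be k/4) over F.
  data Point (b : Carrier) : Set (c ⊔ ℓ) where
    O   : Point b
    aff : (x y : Carrier) → y * y ≈ cube x + b → Point b

  data Add {b : Carrier} : Point b → Point b → Point b → Set (c ⊔ ℓ) where
    O-left  : ∀ Q → Add O Q Q
    O-right : ∀ P → Add P O P
    opposite : ∀ {x₁ y₁ x₂ y₂ p₁ p₂} →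
      x₁ ≈ x₂ → y₁ ≈ - y₂ → Add (aff x₁ y₁ p₁) (aff x₂ y₂ p₂) O
    chord : ∀ {x₁ y₁ x₂ y₂ x₃ y₃ p₁ p₂ p₃} (λ′ : Carrier) →
      ¬ (x₁ ≈ x₂) →
      λ′ * (x₂ - x₁) ≈ y₂ - y₁ →
      x₃ ≈ λ′ * λ′ - x₁ - x₂ →
      y₃ ≈ λ′ * (x₁ - x₃) - y₁ →
      Add (aff x₁ y₁ p₁) (aff x₂ y₂ p₂) (aff x₃ y₃ p₃)
    tangent : ∀ {x₁ y₁ x₂ y₂ x₃ y₃ p₁ p₂ p₃} (λ′ : Carrier) →
      x₁ ≈ x₂ → y₁ ≈ y₂ → ¬ (y₁ ≈ 0#) →
      λ′ * (two * y₁) ≈ three * (x₁ * x₁) →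
      x₃ ≈ λ′ * λ′ - x₁ - x₂ →
      y₃ ≈ λ′ * (x₁ - x₃) - y₁ →
      Add (aff x₁ y₁ p₁) (aff x₂ y₂ p₂) (aff x₃ y₃ p₃)

  -- The map ψ_k as a relation  Psi P Q  meaning  ψ_k(P) = Q, for fixed
  -- s3 = √-3 and sk = √k; b = k/4.
  -- ψ(O) = O, ψ(0, ±√k/2) = O, and for x ≠ 0
  -- ψ(x,y) = ( -(x³+k)/(3x²) , -y(x³-2k)/(3√-3 x³) ).
  data Psi (k s3 sk : Carrier) {b : Carrier} : Point b → Point b → Set (c ⊔ ℓ) where
    psi-O : Psi k s3 sk O O
    psi-2tors : ∀ {x y p} → x ≈ 0# → (two * y ≈ sk ⊎ two * y ≈ - sk) →
      Psi k s3 sk (aff x y p) O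
    psi-aff : ∀ {x y p x′ y′ p′} → ¬ (x ≈ 0#) →
      three * (x * x) * x′ ≈ - (cube x + k) →
      three * s3 * cube x * y′ ≈ - (y * (cube x - two * k)) →
      Psi k s3 sk (aff x y p) (aff x′ y′ p′)

  InTorsionSet : {b : Carrier} → Point b → Set (c ⊔ ℓ)
  InTorsionSet {b} O = ⊤
  InTorsionSet {b} (aff x y p) = ∃ λ c′ → cube c′ ≈ b × x ≈ - c′ × y ≈ 0#

{-# OPTIONS --safe #-}
module Submission where

-- Doubling an affine point (x, y) of y² = x³ + b gives O exactly when y = 0, which on the
-- curve means x³ = -b, i.e. (x, y) = (-c, 0) with c³ = b.  For ψ, with k = 4b the
-- x-equation 3x³ = -(x³ + k) reads 4(x³ + b) = 0, and given x³ = -b the y-equation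
-- reduces to 3b(√-3 + 3)y = 0; as √-3 = -3 would force 12 = 0, this is again y = 0.

open import Defs
open import Level using (Level)
open import Data.Product using (_×_; _,_)
open import Data.Unit.Polymorphic using (tt)
open import Function.Bundles using (_⇔_; mk⇔; module Equivalence)
open import Function.Properties.Equivalence using () renaming (sym to ⇔-sym; trans to ⇔-trans)
open import Relation.Nullary using (¬_)

module Properties {c ℓ : Level} (F : Field c ℓ) where
  open Field F
  open FieldTheory F
  open import Algebra.Properties.Ring ring
    using ( -0#≈0#; -‿involutive; -‿distribˡ-*; -‿distribʳ-*; //-rightDividesˡ
          ; +-identityˡ-unique; +-inverseˡ-unique; +-inverseʳ-unique)
  open import Algebra.Solver.Ring.NaturalCoefficients.Default commutativeSemiring
    using (solve; _:=_; con; _:+_; _:*_; Polynomial)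
  open import Relation.Binary.Reasoning.Setoid setoid

  -- The solver works over the commutative semiring, so ring identities are stated without subtraction.
  private
    2ᴾ 3ᴾ : ∀ {n} → Polynomial n
    2ᴾ = con 1 :+ con 1
    3ᴾ = con 1 :+ con 1 :+ con 1

  x≈0⇒y*x≈0 : ∀ {x} y → x ≈ 0# → y * x ≈ 0#
  x≈0⇒y*x≈0 y x≈0 = trans (*-congˡ x≈0) (zeroʳ y)

  x≉0⇒x*y≈0⇒y≈0 : ∀ {x y} → ¬ (x ≈ 0#) → x * y ≈ 0# → y ≈ 0#
  x≉0⇒x*y≈0⇒y≈0 {x} {y} x≉0 xy≈0 with inverse x x≉0
  ... | x⁻¹ , xx⁻¹≈1 = begin
    y              ≈⟨ *-identityˡ y ⟨
    1# * y         ≈⟨ *-congʳ (trans (sym xx⁻¹≈1) (*-comm x x⁻¹)) ⟩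
    x⁻¹ * x * y    ≈⟨ *-assoc x⁻¹ x y ⟩
    x⁻¹ * (x * y)  ≈⟨ x≈0⇒y*x≈0 x⁻¹ xy≈0 ⟩
    0#             ∎

  x≉0⇒y≉0⇒x*y≉0 : ∀ {x y} → ¬ (x ≈ 0#) → ¬ (y ≈ 0#) → ¬ (x * y ≈ 0#)
  x≉0⇒y≉0⇒x*y≉0 x≉0 y≉0 xy≈0 = y≉0 (x≉0⇒x*y≈0⇒y≈0 x≉0 xy≈0)

  x≈0⇒x≈-x : ∀ {x} → x ≈ 0# → x ≈ - x
  x≈0⇒x≈-x x≈0 = trans x≈0 (trans (sym -0#≈0#) (-‿cong (sym x≈0)))

  x≈-x⇒x≈0 : ¬ (two ≈ 0#) → ∀ {x} → x ≈ - x → x ≈ 0#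
  x≈-x⇒x≈0 2≉0 {x} x≈-x = x≉0⇒x*y≈0⇒y≈0 2≉0 (begin
    two * x          ≈⟨ distribʳ x 1# 1# ⟩
    1# * x + 1# * x  ≈⟨ +-cong (*-identityˡ x) (*-identityˡ x) ⟩
    x + x            ≈⟨ +-congʳ x≈-x ⟩
    - x + x          ≈⟨ -‿inverseˡ x ⟩
    0#               ∎)

  cube-‿ : ∀ x → cube (- x) ≈ - cube x
  cube-‿ x = begin
    - x * - x * - x    ≈⟨ *-congʳ (-‿distribˡ-* x (- x)) ⟨
    - (x * - x) * - x  ≈⟨ *-congʳ (-‿cong (-‿distribʳ-* x x)) ⟨
    - - (x * x) * - x  ≈⟨ *-congʳ (-‿involutive (x * x)) ⟩
    x * x * - x        ≈⟨ -‿distribʳ-* (x * x) x ⟨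
    - (x * x * x)      ∎

  s*s≈-3⇒s+3≉0 : CharNot2or3 → ∀ {s} → s * s ≈ - three → ¬ (s + three ≈ 0#)
  s*s≈-3⇒s+3≉0 (2≉0 , 3≉0) {s} s*s≈-3 s+3≈0 =
    x≉0⇒y≉0⇒x*y≉0 (x≉0⇒y≉0⇒x*y≉0 2≉0 2≉0) 3≉0 (begin
      two * two * three                      ≈⟨ +-identityʳ _ ⟨
      two * two * three + 0#                 ≈⟨ +-congˡ (x≈0⇒y*x≈0 s s+3≈0) ⟨
      two * two * three + s * (s + three)    ≈⟨ identity s ⟩
      (s * s + three) + three * (s + three)  ≈⟨ +-cong s*s+3≈0 (x≈0⇒y*x≈0 three s+3≈0) ⟩
      0# + 0#                                ≈⟨ +-identityʳ 0# ⟩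
      0#                                     ∎)
    where
    s*s+3≈0 : s * s + three ≈ 0#
    s*s+3≈0 = trans (+-congʳ s*s≈-3) (-‿inverseˡ three)

    identity : ∀ s → two * two * three + s * (s + three) ≈ (s * s + three) + three * (s + three)
    identity = solve 1 (λ s → 2ᴾ :* 2ᴾ :* 3ᴾ :+ s :* (s :+ 3ᴾ) := (s :* s :+ 3ᴾ) :+ 3ᴾ :* (s :+ 3ᴾ)) refl

  y≈0⇒x³+b≈0 : ∀ {b x y} → y * y ≈ cube x + b → y ≈ 0# → cube x + b ≈ 0#
  y≈0⇒x³+b≈0 {y = y} onCurve y≈0 = trans (sym onCurve) (trans (*-congʳ y≈0) (zeroˡ y))

  2P≈O⇔y≈0 : ¬ (two ≈ 0#) → ∀ {b x y p} → Add {b} (aff x y p) (aff x y p) O ⇔ y ≈ 0#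
  2P≈O⇔y≈0 2≉0 = mk⇔
    (λ { (opposite _ y≈-y) → x≈-x⇒x≈0 2≉0 y≈-y })
    (λ y≈0 → opposite refl (x≈0⇒x≈-x y≈0))

  P∈torsion⇔y≈0 : ∀ {b x y p} → InTorsionSet {b} (aff x y p) ⇔ y ≈ 0#
  P∈torsion⇔y≈0 {x = x} {p = p} = mk⇔
    (λ { (_ , _ , _ , y≈0) → y≈0 })
    (λ y≈0 → - x
           , trans (cube-‿ x) (sym (+-inverseʳ-unique _ _ (y≈0⇒x³+b≈0 p y≈0)))
           , sym (-‿involutive x)
           , y≈0)

  module PsiFixedPoints (2≉0 : ¬ (two ≈ 0#)) (3≉0 : ¬ (three ≈ 0#))
                        {k b : Carrier} (k≉0 : ¬ (k ≈ 0#)) (4b≈k : two * two * b ≈ k) where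

    b≉0 : ¬ (b ≈ 0#)
    b≉0 b≈0 = k≉0 (trans (sym 4b≈k) (x≈0⇒y*x≈0 (two * two) b≈0))

    x³+b≈0⇒x≉0 : ∀ {x} → cube x + b ≈ 0# → ¬ (x ≈ 0#)
    x³+b≈0⇒x≉0 {x} x³+b≈0 x≈0 = b≉0 (begin
      b             ≈⟨ +-identityˡ b ⟨
      0# + b        ≈⟨ +-congʳ (x≈0⇒y*x≈0 (x * x) x≈0) ⟨
      cube x + b    ≈⟨ x³+b≈0 ⟩
      0#            ∎)

    psi-x-equation⇔x³+b≈0 : ∀ {x} → three * (x * x) * x ≈ - (cube x + k) ⇔ cube x + b ≈ 0#
    psi-x-equation⇔x³+b≈0 {x} = mk⇔
      (λ eq → x≉0⇒x*y≈0⇒y≈0 (x≉0⇒y≉0⇒x*y≉0 2≉0 2≉0) (begin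
        two * two * (cube x + b)                        ≈⟨ identity x b ⟨
        three * (x * x) * x + (cube x + two * two * b)  ≈⟨ +-congˡ (+-congˡ 4b≈k) ⟩
        three * (x * x) * x + (cube x + k)              ≈⟨ +-congʳ eq ⟩
        - (cube x + k) + (cube x + k)                   ≈⟨ -‿inverseˡ (cube x + k) ⟩
        0#                                              ∎))
      (λ x³+b≈0 → +-inverseˡ-unique _ _ (begin
        three * (x * x) * x + (cube x + k)              ≈⟨ +-congˡ (+-congˡ 4b≈k) ⟨
        three * (x * x) * x + (cube x + two * two * b)  ≈⟨ identity x b ⟩
        two * two * (cube x + b)                        ≈⟨ x≈0⇒y*x≈0 (two * two) x³+b≈0 ⟩
        0#                                              ∎))
      where
      identity : ∀ x b → three * (x * x) * x + (cube x + two * two * b) ≈ two * two * (cube x + b)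
      identity = solve 2 (λ x b →
        3ᴾ :* (x :* x) :* x :+ (x :* x :* x :+ 2ᴾ :* 2ᴾ :* b) := 2ᴾ :* 2ᴾ :* (x :* x :* x :+ b)) refl

    psi-y-equation⇒y≈0 : ∀ {x y s} → s * s ≈ - three → cube x + b ≈ 0# →
                         three * s * cube x * y ≈ - (y * (cube x - two * k)) → y ≈ 0#
    psi-y-equation⇒y≈0 {x} {y} {s} s*s≈-3 x³+b≈0 eq = x≉0⇒x*y≈0⇒y≈0 3b[s+3]≉0
      (+-identityˡ-unique _ _ (begin
        three * b * (s + three) * y + (three * s * X * y + y * X)  ≈⟨ identity X b s y ⟩
        (three * s * y + y) * (X + b) + y * (two * (two * two * b))
          ≈⟨ +-cong (x≈0⇒y*x≈0 _ x³+b≈0) (*-congˡ (*-congˡ 4b≈k)) ⟩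
        0# + y * (two * k)                                         ≈⟨ +-identityˡ _ ⟩
        y * (two * k)                                              ≈⟨ eq-without-subtraction ⟨
        three * s * X * y + y * X                                  ∎))
      where
      X : Carrier
      X = cube x

      3b[s+3]≉0 : ¬ (three * b * (s + three) ≈ 0#)
      3b[s+3]≉0 = x≉0⇒y≉0⇒x*y≉0 (x≉0⇒y≉0⇒x*y≉0 3≉0 b≉0) (s*s≈-3⇒s+3≉0 (2≉0 , 3≉0) s*s≈-3)

      eq-without-subtraction : three * s * X * y + y * X ≈ y * (two * k)
      eq-without-subtraction = begin
        three * s * X * y + y * X
          ≈⟨ +-congˡ (*-congˡ (//-rightDividesˡ (two * k) X)) ⟨
        three * s * X * y + y * (X - two * k + two * k)
          ≈⟨ +-congˡ (distribˡ y _ _) ⟩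
        three * s * X * y + (y * (X - two * k) + y * (two * k))
          ≈⟨ +-assoc _ _ _ ⟨
        three * s * X * y + y * (X - two * k) + y * (two * k)
          ≈⟨ +-congʳ (trans (+-congʳ eq) (-‿inverseˡ _)) ⟩
        0# + y * (two * k)
          ≈⟨ +-identityˡ _ ⟩
        y * (two * k)
          ∎

      identity : ∀ X b s y → three * b * (s + three) * y + (three * s * X * y + y * X)
                           ≈ (three * s * y + y) * (X + b) + y * (two * (two * two * b))
      identity = solve 4 (λ X b s y →
        3ᴾ :* b :* (s :+ 3ᴾ) :* y :+ (3ᴾ :* s :* X :* y :+ y :* X)
          := (3ᴾ :* s :* y :+ y) :* (X :+ b) :+ y :* (2ᴾ :* (2ᴾ :* 2ᴾ :* b))) refl

    ψP≈P⇔y≈0 : ∀ {s3 sk x y p} → s3 * s3 ≈ - three →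
               Psi k s3 sk (aff x y p) (aff x y p) ⇔ y ≈ 0#
    ψP≈P⇔y≈0 {s3} {sk} {x} {y} {p} s3*s3≈-3 = mk⇔ ψP≈P⇒y≈0 y≈0⇒ψP≈P
      where
      ψP≈P⇒y≈0 : Psi k s3 sk (aff x y p) (aff x y p) → y ≈ 0#
      ψP≈P⇒y≈0 (psi-aff _ x-eq y-eq) =
        psi-y-equation⇒y≈0 s3*s3≈-3 (Equivalence.to psi-x-equation⇔x³+b≈0 x-eq) y-eq

      y≈0⇒ψP≈P : y ≈ 0# → Psi k s3 sk (aff x y p) (aff x y p)
      y≈0⇒ψP≈P y≈0 = psi-aff (x³+b≈0⇒x≉0 x³+b≈0)
                             (Equivalence.from psi-x-equation⇔x³+b≈0 x³+b≈0)
                             (trans lhs≈0 (sym rhs≈0))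
        where
        x³+b≈0 : cube x + b ≈ 0#
        x³+b≈0 = y≈0⇒x³+b≈0 p y≈0

        lhs≈0 : three * s3 * cube x * y ≈ 0#
        lhs≈0 = x≈0⇒y*x≈0 _ y≈0

        rhs≈0 : - (y * (cube x - two * k)) ≈ 0#
        rhs≈0 = trans (-‿cong (trans (*-congʳ y≈0) (zeroˡ _))) -0#≈0#

lemma4p1 : ∀ {c ℓ : Level} (F : Field c ℓ) →
    let open Field F in
    let open FieldTheory F in
    AlgClosed → CharNot2or3 →
    (k : Carrier) → ¬ (k ≈ 0#) →
    (b : Carrier) → (two * two) * b ≈ k →
    (s3 sk : Carrier) → s3 * s3 ≈ - three → sk * sk ≈ k →
    (P : Point b) →
      (Psi k s3 sk P P ⇔ Add P P O) × (Add P P O ⇔ InTorsionSet P)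
lemma4p1 F _ (2≉0 , 3≉0) k k≉0 b 4b≈k s3 sk s3*s3≈-3 _ = fixedPoints
  where
  open FieldTheory F
  open Properties F
  open PsiFixedPoints 2≉0 3≉0 k≉0 4b≈k

  fixedPoints : (P : Point b) → (Psi k s3 sk P P ⇔ Add P P O) × (Add P P O ⇔ InTorsionSet P)
  fixedPoints O = mk⇔ (λ _ → O-left O) (λ _ → psi-O) , mk⇔ (λ _ → tt) (λ _ → O-left O)
  fixedPoints (aff x y p) =
      ⇔-trans (ψP≈P⇔y≈0 s3*s3≈-3) (⇔-sym (2P≈O⇔y≈0 2≉0))
    , ⇔-trans (2P≈O⇔y≈0 2≉0) (⇔-sym (P∈torsion⇔y≈0 {p = p}))
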